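{- Let $n\ge 0$ and let $f,g\in\Delta$ be homogeneous of degree $n$. Then $\langle f,g\rangle\in 2^{\,n-a(n)}\mathbb Z_{(2)}$, where $a(n)$ is the largest integer $m$ such that $\frac{m(m+1)}{2}\le n$.
   Context: Let $R=\mathbb C[p_1,p_3,p_5,\ldots]$ be the polynomial ring in variables $p_k$ indexed by odd positive integers $k$, graded by giving $p_k$ degree $k$. For a partition $\mu=(\mu_1,\dots,\mu_\ell)$ with all parts odd, set $p_\mu=p_{\mu_1}\cdots p_{\mu_\ell}$ and $z_\mu=\prod_{k\text{ odd}}k^{m_k}m_k!$, where $m_k$ is the multiplicity of $k$ in $\mu$. The bilinear form $\langle\cdot,\cdot\rangle$ on $R$ is the one for which the monomials $p_\mu$ are pairwise orthogonal and $\langle p_\mu,p_\mu\rangle=z_\mu$. Let $\mathbb Z_{(2)}=\{a/b: a,b\in\mathbb Z,\ b\text{ odd}\}$ and $\Delta=\mathbb Z_{(2)}[p_1,2p_3,4p_5,\ldots]=\mathbb Z_{(2)}[2^kp_{2k+1}:k\ge0]\subset R$. -}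

module Defs where

open import Data.Nat as ℕ using (ℕ; suc; _+_; _*_; _^_; _!)
open import Data.Nat.Properties using (≤-decTotalOrder)
open import Data.Integer as ℤ using (ℤ; +_)
open import Data.Rational as ℚ using (ℚ; 0ℚ; 1ℚ)
open import Data.List using (List; []; _∷_; map; filter; length; foldr; deduplicate)
open import Data.Nat.ListAction using (product)
import Data.List.Properties as LP
open import Data.List.Sort ≤-decTotalOrder using (sort)
open import Data.List.Relation.Unary.All using (All)
open import Data.Product using (_×_; _,_; Σ; proj₁; proj₂)
open import Relation.Nullary using (yes; no)
open import Relation.Binary.PropositionalEquality using (_≡_)

-- A monomial p_μ of R = ℂ[p₁,p₃,p₅,…], μ an odd partition, encoded as the
-- list of indices k of its parts 2k+1 (order irrelevant: μ is a multiset).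
Mono : Set
Mono = List ℕ

deg : Mono → ℕ
deg μ = foldr (λ k s → suc (2 * k) + s) 0 μ

mult : ℕ → Mono → ℕ
mult k μ = length (filter (ℕ._≟ k) μ)

z : Mono → ℕ
z μ = product (map (λ k → suc (2 * k) ^ mult k μ * (mult k μ) !) (deduplicate ℕ._≟_ μ))

ℕ→ℚ : ℕ → ℚ
ℕ→ℚ n = + n ℚ./ 1

monoForm : Mono → Mono → ℚ
monoForm μ ν with LP.≡-dec ℕ._≟_ (sort μ) (sort ν)
... | yes _ = ℕ→ℚ (z μ)
... | no  _ = 0ℚ

-- Elements of R (with the needed coefficients) as finite formal sums Σ c·p_μ.
-- The coefficients of all elements that occur here lie in ℤ₍₂₎ ⊂ ℚ ⊂ ℂ.
RPoly : Set
RPoly = List (ℚ × Mono)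

sumℚ : List ℚ → ℚ
sumℚ = foldr ℚ._+_ 0ℚ

form : RPoly → RPoly → ℚ
form f g = sumℚ (map (λ t → sumℚ (map (λ s → proj₁ t ℚ.* proj₁ s ℚ.* monoForm (proj₂ t) (proj₂ s)) g)) f)

InZ2 : ℚ → Set
InZ2 x = Σ ℤ λ a → Σ ℕ λ c → x ≡ a ℚ./ suc (2 * c)

In2PowZ2 : ℕ → ℚ → Set
In2PowZ2 e x = Σ ℚ λ y → InZ2 y × x ≡ ℕ→ℚ (2 ^ e) ℚ.* y

-- Elements of Δ = ℤ₍₂₎[q₀,q₁,…], q_k = 2^k p_{2k+1}, written as formal sums
-- Σ c · q_μ, where q_μ = ∏_{k∈μ} q_k  (μ : Mono as above).
ΔExpr : Set
ΔExpr = List (ℚ × Mono)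

HomogΔ : ℕ → ΔExpr → Set
HomogΔ n e = All (λ t → InZ2 (proj₁ t) × deg (proj₂ t) ≡ n) e

sumℕ : List ℕ → ℕ
sumℕ = foldr _+_ 0

toR : ΔExpr → RPoly
toR = map (λ t → (proj₁ t ℚ.* ℕ→ℚ (2 ^ sumℕ (proj₂ t)) , proj₂ t))

-- Write a monomial q_μ of degree n as 2^s p_μ with s = Σ k over the parts 2k+1 of μ, so
-- n = 2s + ℓ(μ) and the only nonzero pairings are ⟨q_μ, q_μ⟩ = 2^{2s} z_μ. It therefore
-- suffices that 2^{ℓ(μ)} divides 2^m z_μ. Glaisher's map splits the m_k parts equal to 2k+1
-- into the parts 2^j (2k+1), j running over the binary digits of m_k; the result is a
-- partition of n into B distinct parts, so B(B+1)/2 ≤ n and hence B ≤ m. By Legendre's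
-- formula 2^{m_k} divides 2^{s₂(m_k)} m_k!, and the s₂(m_k) add up to B, so 2^{ℓ(μ)}
-- divides 2^B z_μ.
module Submission where

open import Defs
open import Data.Nat using (ℕ; suc; _*_; _≤_; _∸_)

open import Data.Nat using (zero; _+_; _^_; _!; _<_; _≟_; _≤?_; z≤n; s≤s)
open import Data.Nat.Properties
open import Data.Nat.Divisibility
open import Data.Nat.Induction using (<-rec)
open import Data.Nat.ListAction using (sum; product)
open import Data.Nat.ListAction.Properties using (sum-++; sum-↭)
open import Data.Nat.Tactic.RingSolver using (solve-∀)
import Data.Integer as ℤ
open import Data.Integer.Properties using (pos-*)
open import Data.Rational as ℚ using (0ℚ; fromℚᵘ; toℚᵘ)
import Data.Rational.Properties as ℚ
open import Data.Rational.Unnormalised as ℚᵘ using (mkℚᵘ)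
import Data.Rational.Unnormalised.Properties as ℚᵘ
open import Data.List using (List; []; _∷_; map; length; _++_; deduplicate)
open import Data.List.Properties
  using (length-map; length-++; map-cong; foldr-map; filter-accept; filter-reject; ≡-dec)
open import Data.List.Membership.Propositional using (_∈_; _∉_)
open import Data.List.Membership.Propositional.Properties using (∈-map⁻; ∈-++⁻; ∈-deduplicate⁺)
open import Data.List.Relation.Unary.Any using (here; there)
open import Data.List.Relation.Unary.All as All using (All; []; _∷_)
import Data.List.Relation.Unary.All.Properties as All
open import Data.List.Relation.Unary.AllPairs as AllPairs using (AllPairs; []; _∷_)
open import Data.List.Relation.Unary.Linked.Properties using (Linked⇒AllPairs)
open import Data.List.Relation.Unary.Unique.Propositional using (Unique)
import Data.List.Relation.Unary.Unique.Propositional.Properties as Unique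
open import Data.List.Relation.Unary.Unique.DecPropositional.Properties _≟_ using (deduplicate-!)
open import Data.List.Relation.Binary.Permutation.Propositional using (_↭_; ↭-sym; ↭-trans; ↭⇒↭ₛ)
open import Data.List.Relation.Binary.Permutation.Propositional.Properties using (All-resp-↭; ↭-length)
open import Data.List.Sort ≤-decTotalOrder using (sort; sort-↭; sort-↗)
open import Data.Product using (∃; _×_; _,_; proj₁; proj₂; uncurry)
open import Data.Sum using (inj₁; inj₂)
open import Function using (_∘_)
open import Relation.Nullary using (yes; no; contradiction)
open import Relation.Binary.PropositionalEquality
open import Data.List.Relation.Binary.Permutation.Setoid.Properties (setoid ℕ) using (Unique-resp-↭)
open import Algebra.Bundles using (CommutativeMonoid)
open import Algebra.Properties.CommutativeSemigroup *-commutativeSemigroup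
  using (x∙yz≈y∙xz; x∙yz≈xz∙y; interchange)
open import Algebra.Properties.CommutativeSemigroup +-commutativeSemigroup
  using () renaming (x∙yz≈y∙xz to +-x∙yz≈y∙xz)
import Algebra.Properties.CommutativeSemigroup
  (CommutativeMonoid.commutativeSemigroup ℚ.*-1-commutativeMonoid) as ℚ*

-- Binary expansions and Legendre's formula at 2

data EvenOrOdd : ℕ → Set where
  even : ∀ q → EvenOrOdd (q + q)
  odd  : ∀ q → EvenOrOdd (suc (q + q))

evenOrOdd : ∀ n → EvenOrOdd n
evenOrOdd zero = even 0
evenOrOdd (suc n) with evenOrOdd n
... | even q = odd q
... | odd q  = subst EvenOrOdd (cong suc (+-suc q q)) (even (suc q))

2^n*n!∣[n+n]! : ∀ n → 2 ^ n * n ! ∣ (n + n) !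
2^n*n!∣[n+n]! zero    = ∣-refl
2^n*n!∣[n+n]! (suc n) = begin
  2 ^ suc n * suc n !                ≡⟨ regroup (2 ^ n) (n !) n ⟩
  suc (suc (n + n)) * (2 ^ n * n !)  ∣⟨ *-monoʳ-∣ (suc (suc (n + n)))
                                          (∣n⇒∣m*n (suc (n + n)) (2^n*n!∣[n+n]! n)) ⟩
  suc (suc (n + n)) !                ≡⟨ cong (_! ∘ suc) (+-suc n n) ⟨
  (suc n + suc n) !                  ∎
  where
  open ∣-Reasoning
  regroup : ∀ a b n → (2 * a) * (suc n * b) ≡ suc (suc (n + n)) * (a * b)
  regroup = solve-∀

2*n≡n+n : ∀ n → 2 * n ≡ n + n
2*n≡n+n n = cong (n +_) (+-identityʳ n)

sum-map-2^suc : ∀ js → sum (map (2 ^_) (map suc js)) ≡ 2 * sum (map (2 ^_) js)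
sum-map-2^suc []       = refl
sum-map-2^suc (j ∷ js) =
  trans (cong (2 ^ suc j +_) (sum-map-2^suc js)) (sym (*-distribˡ-+ 2 (2 ^ j) _))

record BinaryExpansion (m : ℕ) : Set where
  field
    positions        : List ℕ
    positions-unique : Unique positions
    sum-2^positions  : sum (map (2 ^_) positions) ≡ m
    -- Legendre's formula v₂(m!) = m − s₂(m), as a divisibility.
    2^m∣2^#positions*m! : 2 ^ m ∣ 2 ^ length positions * m !

double : ∀ {q} → BinaryExpansion q → BinaryExpansion (q + q)
double {q} e = record
  { positions        = map suc positions
  ; positions-unique = Unique.map⁺ suc-injective positions-unique
  ; sum-2^positions  =
      trans (sum-map-2^suc positions) (trans (cong (2 *_) sum-2^positions) (2*n≡n+n q))
  ; 2^m∣2^#positions*m! =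
      subst (λ l → 2 ^ (q + q) ∣ 2 ^ l * (q + q) !) (sym (length-map suc positions)) legendre
  }
  where
  open BinaryExpansion e
  legendre : 2 ^ (q + q) ∣ 2 ^ length positions * (q + q) !
  legendre = begin
    2 ^ (q + q)                           ≡⟨ ^-distribˡ-+-* 2 q q ⟩
    2 ^ q * 2 ^ q                         ∣⟨ *-monoʳ-∣ (2 ^ q) 2^m∣2^#positions*m! ⟩
    2 ^ q * (2 ^ length positions * q !)  ≡⟨ x∙yz≈y∙xz (2 ^ q) (2 ^ length positions) (q !) ⟩
    2 ^ length positions * (2 ^ q * q !)  ∣⟨ *-monoʳ-∣ (2 ^ length positions) (2^n*n!∣[n+n]! q) ⟩
    2 ^ length positions * (q + q) !      ∎
    where open ∣-Reasoning

double+1 : ∀ {q} → BinaryExpansion q → BinaryExpansion (suc (q + q))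
double+1 {q} e = record
  { positions        = 0 ∷ positions
  ; positions-unique =
      All.map⁺ (All.universal (λ _ ()) (BinaryExpansion.positions e)) ∷ positions-unique
  ; sum-2^positions  = cong suc sum-2^positions
  ; 2^m∣2^#positions*m! = subst (2 ^ suc (q + q) ∣_) (sym (*-assoc 2 (2 ^ ℓ) (suc (q + q) !)))
      (*-monoʳ-∣ 2 (∣-trans 2^m∣2^#positions*m! (*-monoʳ-∣ (2 ^ ℓ) (n∣m*n (suc (q + q))))))
  }
  where
  open BinaryExpansion (double e)
  ℓ = length positions

binaryExpansion : ∀ m → BinaryExpansion m
binaryExpansion = <-rec BinaryExpansion expand
  where
  expand : ∀ m → (∀ {k} → k < m → BinaryExpansion k) → BinaryExpansion m
  expand m rec with evenOrOdd m
  ... | even zero    = record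
    { positions = [] ; positions-unique = [] ; sum-2^positions = refl ; 2^m∣2^#positions*m! = ∣-refl }
  ... | even (suc q) = double (rec (s≤s (m≤n+m (suc q) q)))
  ... | odd q        = double+1 (rec (s≤s (m≤m+n q q)))

bitPositions : ℕ → List ℕ
bitPositions m = BinaryExpansion.positions (binaryExpansion m)

-- Glaisher's map to partitions into distinct parts

2^j*odd-injective : ∀ j j′ {k k′} → 2 ^ j * suc (2 * k) ≡ 2 ^ j′ * suc (2 * k′) → j ≡ j′ × k ≡ k′
2^j*odd-injective zero zero {k} {k′} eq =
  refl , *-cancelˡ-≡ k k′ 2 (suc-injective (trans (sym (*-identityˡ _)) (trans eq (*-identityˡ _))))
2^j*odd-injective zero (suc j′) {k} {k′} eq = contradiction
  (trans (sym (*-assoc 2 (2 ^ j′) (suc (2 * k′)))) (trans (sym eq) (*-identityˡ _)))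
  (even≢odd (2 ^ j′ * suc (2 * k′)) k)
2^j*odd-injective (suc j) zero {k} {k′} eq = contradiction
  (trans (sym (*-assoc 2 (2 ^ j) (suc (2 * k)))) (trans eq (*-identityˡ _)))
  (even≢odd (2 ^ j * suc (2 * k)) k′)
2^j*odd-injective (suc j) (suc j′) {k} {k′} eq =
  let j≡j′ , k≡k′ = 2^j*odd-injective j j′ (*-cancelˡ-≡ _ _ 2
        (trans (sym (*-assoc 2 (2 ^ j) _)) (trans eq (*-assoc 2 (2 ^ j′) _))))
  in cong suc j≡j′ , k≡k′

-- M k is the multiplicity of the part 2k+1, and D lists the k that occur.
glaisher : (ℕ → ℕ) → List ℕ → List ℕ
glaisher M []      = []
glaisher M (k ∷ D) = map (λ j → 2 ^ j * suc (2 * k)) (bitPositions (M k)) ++ glaisher M D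

∈-glaisher⁻ : ∀ M D {v} → v ∈ glaisher M D → ∃ λ k → k ∈ D × ∃ λ j → v ≡ 2 ^ j * suc (2 * k)
∈-glaisher⁻ M (k ∷ D) v∈ with ∈-++⁻ (map (λ j → 2 ^ j * suc (2 * k)) (bitPositions (M k))) v∈
... | inj₁ v∈block = let j , _ , v≡ = ∈-map⁻ _ v∈block in k , here refl , j , v≡
... | inj₂ v∈rest  = let k′ , k′∈D , j , v≡ = ∈-glaisher⁻ M D v∈rest in k′ , there k′∈D , j , v≡

glaisher-unique : ∀ M {D} → Unique D → Unique (glaisher M D)
glaisher-unique M {[]}    []           = []
glaisher-unique M {k ∷ D} (k∉D ∷ uD) = Unique.++⁺
  (Unique.map⁺ (λ {j} {j′} → proj₁ ∘ 2^j*odd-injective j j′ {k} {k})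
    (BinaryExpansion.positions-unique (binaryExpansion (M k))))
  (glaisher-unique M uD)
  disjoint
  where
  disjoint : ∀ {v} → v ∈ map (λ j → 2 ^ j * suc (2 * k)) (bitPositions (M k)) × v ∈ glaisher M D → _
  disjoint (v∈block , v∈rest) with ∈-map⁻ _ v∈block | ∈-glaisher⁻ M D v∈rest
  ... | j , _ , refl | k′ , k′∈D , j′ , v≡ = All.lookup k∉D k′∈D (proj₂ (2^j*odd-injective j j′ v≡))

glaisher-positive : ∀ M D → All (0 <_) (glaisher M D)
glaisher-positive M []      = []
glaisher-positive M (k ∷ D) =
  All.++⁺ (All.map⁺ (All.universal (λ j → *-mono-≤ (m^n>0 2 j) (s≤s z≤n)) (bitPositions (M k))))
          (glaisher-positive M D)

sum-map-*ʳ : ∀ (f : ℕ → ℕ) c xs → sum (map (λ x → f x * c) xs) ≡ sum (map f xs) * c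
sum-map-*ʳ f c []       = refl
sum-map-*ʳ f c (x ∷ xs) =
  trans (cong (f x * c +_) (sum-map-*ʳ f c xs)) (sym (*-distribʳ-+ c (f x) _))

sum-glaisher : ∀ M D → sum (glaisher M D) ≡ sum (map (λ k → M k * suc (2 * k)) D)
sum-glaisher M []      = refl
sum-glaisher M (k ∷ D) = begin
  sum (map (λ j → 2 ^ j * suc (2 * k)) (bitPositions (M k)) ++ glaisher M D)
    ≡⟨ sum-++ (map _ (bitPositions (M k))) _ ⟩
  sum (map (λ j → 2 ^ j * suc (2 * k)) (bitPositions (M k))) + sum (glaisher M D)
    ≡⟨ cong₂ _+_ (sum-map-*ʳ (2 ^_) _ (bitPositions (M k))) (sum-glaisher M D) ⟩
  sum (map (2 ^_) (bitPositions (M k))) * suc (2 * k) + sum (map (λ k → M k * suc (2 * k)) D)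
    ≡⟨ cong (λ x → x * suc (2 * k) + _) (BinaryExpansion.sum-2^positions (binaryExpansion (M k))) ⟩
  M k * suc (2 * k) + sum (map (λ k → M k * suc (2 * k)) D)
    ∎
  where open ≡-Reasoning

glaisher-2^∣ : ∀ M D →
  2 ^ sum (map M D) ∣ 2 ^ length (glaisher M D) * product (map (λ k → suc (2 * k) ^ M k * M k !) D)
glaisher-2^∣ M []      = ∣-refl
glaisher-2^∣ M (k ∷ D) = begin
  2 ^ (M k + sum (map M D))          ≡⟨ ^-distribˡ-+-* 2 (M k) _ ⟩
  2 ^ M k * 2 ^ sum (map M D)        ∣⟨ *-pres-∣ block (glaisher-2^∣ M D) ⟩
  (2 ^ ℓ * t) * (2 ^ ℓ′ * P)         ≡⟨ interchange (2 ^ ℓ) t (2 ^ ℓ′) P ⟩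
  (2 ^ ℓ * 2 ^ ℓ′) * (t * P)         ≡⟨ cong (_* (t * P)) (^-distribˡ-+-* 2 ℓ ℓ′) ⟨
  2 ^ (ℓ + ℓ′) * (t * P)             ≡⟨ cong (λ l → 2 ^ l * (t * P)) length-glaisher ⟨
  2 ^ length (glaisher M (k ∷ D)) * (t * P) ∎
  where
  open ∣-Reasoning
  ds = bitPositions (M k)
  ℓ = length ds
  ℓ′ = length (glaisher M D)
  t = suc (2 * k) ^ M k * M k !
  P = product (map (λ k → suc (2 * k) ^ M k * M k !) D)
  block : 2 ^ M k ∣ 2 ^ ℓ * t
  block = subst (2 ^ M k ∣_) (x∙yz≈y∙xz (suc (2 * k) ^ M k) (2 ^ ℓ) (M k !))
    (∣n⇒∣m*n (suc (2 * k) ^ M k) (BinaryExpansion.2^m∣2^#positions*m! (binaryExpansion (M k))))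
  length-glaisher : length (glaisher M (k ∷ D)) ≡ ℓ + ℓ′
  length-glaisher = trans (length-++ (map _ ds)) (cong (_+ ℓ′) (length-map _ ds))

sum-increasing-above : ∀ b xs → AllPairs _<_ xs → All (b <_) xs →
  length xs * suc (length xs) + 2 * b * length xs ≤ 2 * sum xs
sum-increasing-above b []       _         _        = ≤-reflexive (*-zeroʳ (2 * b))
sum-increasing-above b (x ∷ xs) (x<xs ∷ p) (b<x ∷ _) = begin
  suc ℓ * suc (suc ℓ) + 2 * b * suc ℓ  ≡⟨ shift ℓ b ⟩
  ℓ * suc ℓ + 2 * suc b * suc ℓ        ≤⟨ +-monoʳ-≤ (ℓ * suc ℓ) (*-monoˡ-≤ (suc ℓ) (*-monoʳ-≤ 2 b<x)) ⟩
  ℓ * suc ℓ + 2 * x * suc ℓ            ≡⟨ split ℓ x ⟩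
  2 * x + (ℓ * suc ℓ + 2 * x * ℓ)      ≤⟨ +-monoʳ-≤ (2 * x) (sum-increasing-above x xs p x<xs) ⟩
  2 * x + 2 * sum xs                   ≡⟨ *-distribˡ-+ 2 x (sum xs) ⟨
  2 * (x + sum xs)                     ∎
  where
  open ≤-Reasoning
  ℓ = length xs
  shift : ∀ ℓ b → suc ℓ * suc (suc ℓ) + 2 * b * suc ℓ ≡ ℓ * suc ℓ + 2 * suc b * suc ℓ
  shift = solve-∀
  split : ∀ ℓ x → ℓ * suc ℓ + 2 * x * suc ℓ ≡ 2 * x + (ℓ * suc ℓ + 2 * x * ℓ)
  split = solve-∀

sum-unique-positive : ∀ xs → Unique xs → All (0 <_) xs → length xs * suc (length xs) ≤ 2 * sum xs
sum-unique-positive xs u pos = subst₂ _≤_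
  (trans (+-identityʳ _) (cong (λ ℓ → ℓ * suc ℓ) (↭-length (sort-↭ xs))))
  (cong (2 *_) (sum-↭ (sort-↭ xs)))
  (sum-increasing-above 0 (sort xs) increasing (All-resp-↭ (↭-sym (sort-↭ xs)) pos))
  where
  increasing : AllPairs _<_ (sort xs)
  increasing = AllPairs.zipWith (uncurry ≤∧≢⇒<)
    (Linked⇒AllPairs ≤-trans (sort-↗ xs) , Unique-resp-↭ (↭⇒↭ₛ (↭-sym (sort-↭ xs))) u)

weighted : (ℕ → ℕ) → List ℕ → List ℕ → ℕ
weighted f μ D = sum (map (λ k → mult k μ * f k) D)

mult-∷-≡ : ∀ x μ → mult x (x ∷ μ) ≡ suc (mult x μ)
mult-∷-≡ x μ = cong length (filter-accept (_≟ x) refl)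

mult-∷-≢ : ∀ {x y} μ → x ≢ y → mult y (x ∷ μ) ≡ mult y μ
mult-∷-≢ {y = y} μ x≢y = cong length (filter-reject (_≟ y) x≢y)

weighted-[] : ∀ f D → weighted f [] D ≡ 0
weighted-[] f []      = refl
weighted-[] f (_ ∷ D) = weighted-[] f D

weighted-∷-∉ : ∀ f x μ {D} → x ∉ D → weighted f (x ∷ μ) D ≡ weighted f μ D
weighted-∷-∉ f x μ {[]}    _   = refl
weighted-∷-∉ f x μ {y ∷ D} x∉ =
  cong₂ _+_ (cong (_* f y) (mult-∷-≢ μ (x∉ ∘ here))) (weighted-∷-∉ f x μ (x∉ ∘ there))

weighted-∷-∈ : ∀ f x μ {D} → Unique D → x ∈ D → weighted f (x ∷ μ) D ≡ f x + weighted f μ D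
weighted-∷-∈ f x μ {_ ∷ D} (x∉D ∷ _) (here refl) = begin
  mult x (x ∷ μ) * f x + weighted f (x ∷ μ) D
    ≡⟨ cong₂ (λ c w → c * f x + w) (mult-∷-≡ x μ)
             (weighted-∷-∉ f x μ (λ x∈D → All.lookup x∉D x∈D refl)) ⟩
  (f x + mult x μ * f x) + weighted f μ D
    ≡⟨ +-assoc (f x) _ _ ⟩
  f x + weighted f μ (x ∷ D)
    ∎
  where open ≡-Reasoning
weighted-∷-∈ f x μ {y ∷ D} (y∉D ∷ uD) (there x∈D) = begin
  mult y (x ∷ μ) * f y + weighted f (x ∷ μ) D
    ≡⟨ cong₂ _+_ (cong (_* f y) (mult-∷-≢ μ (All.lookup y∉D x∈D ∘ sym)))
                 (weighted-∷-∈ f x μ uD x∈D) ⟩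
  mult y μ * f y + (f x + weighted f μ D)
    ≡⟨ +-x∙yz≈y∙xz (mult y μ * f y) (f x) _ ⟩
  f x + weighted f μ (y ∷ D)
    ∎
  where open ≡-Reasoning

sum≡weighted : ∀ f μ {D} → Unique D → (∀ {x} → x ∈ μ → x ∈ D) → sum (map f μ) ≡ weighted f μ D
sum≡weighted f []      {D} _  _    = sym (weighted-[] f D)
sum≡weighted f (x ∷ μ) {D} uD μ⊆D = begin
  f x + sum (map f μ)    ≡⟨ cong (f x +_) (sum≡weighted f μ uD (μ⊆D ∘ there)) ⟩
  f x + weighted f μ D   ≡⟨ weighted-∷-∈ f x μ uD (μ⊆D (here refl)) ⟨
  weighted f (x ∷ μ) D   ∎
  where open ≡-Reasoning

-- The 2-adic valuation of ⟨q_μ, q_μ⟩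

support : Mono → List ℕ
support = deduplicate _≟_

sum-over-support : ∀ f μ → sum (map f μ) ≡ weighted f μ (support μ)
sum-over-support f μ = sum≡weighted f μ (deduplicate-! μ) (∈-deduplicate⁺ _≟_)

glaisherOf : Mono → List ℕ
glaisherOf μ = glaisher (λ k → mult k μ) (support μ)

glaisherOf-triangular : ∀ μ → length (glaisherOf μ) * suc (length (glaisherOf μ)) ≤ 2 * deg μ
glaisherOf-triangular μ = subst (λ s → B * suc B ≤ 2 * s) sum≡deg
  (sum-unique-positive (glaisherOf μ) (glaisher-unique M (deduplicate-! μ))
                                      (glaisher-positive M (support μ)))
  where
  M = λ k → mult k μ
  B = length (glaisherOf μ)
  sum≡deg : sum (glaisherOf μ) ≡ deg μ
  sum≡deg = trans (sum-glaisher M (support μ))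
    (trans (sym (sum-over-support (λ k → suc (2 * k)) μ)) (foldr-map _+_ (λ k → suc (2 * k)) 0 μ))

2^length∣2^#glaisherOf*z : ∀ μ → 2 ^ length μ ∣ 2 ^ length (glaisherOf μ) * z μ
2^length∣2^#glaisherOf*z μ = subst (λ e → 2 ^ e ∣ 2 ^ length (glaisherOf μ) * z μ) (sym length≡)
  (glaisher-2^∣ (λ k → mult k μ) (support μ))
  where
  length≡ : length μ ≡ sum (map (λ k → mult k μ) (support μ))
  length≡ = trans (sym (foldr-map _+_ (λ _ → 1) 0 μ)) (trans (sum-over-support (λ _ → 1) μ)
    (cong sum (map-cong (λ k → *-identityʳ (mult k μ)) (support μ))))

deg≡2sum+length : ∀ μ → deg μ ≡ (sumℕ μ + sumℕ μ) + length μ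
deg≡2sum+length []      = refl
deg≡2sum+length (k ∷ μ) =
  trans (cong (suc (2 * k) +_) (deg≡2sum+length μ)) (regroup k (sumℕ μ) (length μ))
  where
  regroup : ∀ k s l → suc (2 * k) + ((s + s) + l) ≡ ((k + s) + (k + s)) + suc l
  regroup = solve-∀

2^-mono-∣ : ∀ {a b} → a ≤ b → 2 ^ a ∣ 2 ^ b
2^-mono-∣ {a} {b} a≤b =
  divides (2 ^ (b ∸ a)) (trans (cong (2 ^_) (sym (m∸n+n≡m a≤b))) (^-distribˡ-+-* 2 (b ∸ a) a))

2^-∣-shift : ∀ t l m {x} → 2 ^ l ∣ 2 ^ m * x → 2 ^ (t + l ∸ m) ∣ 2 ^ t * x
2^-∣-shift t l m {x} d with m ≤? t + l
... | no m≰t+l = subst (λ e → 2 ^ e ∣ 2 ^ t * x) (sym (m≤n⇒m∸n≡0 (<⇒≤ (≰⇒> m≰t+l)))) (1∣ _)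
... | yes m≤t+l = *-cancelʳ-∣ (2 ^ m) {{m^n≢0 2 m}} (begin
  2 ^ (t + l ∸ m) * 2 ^ m  ≡⟨ ^-distribˡ-+-* 2 (t + l ∸ m) m ⟨
  2 ^ (t + l ∸ m + m)      ≡⟨ cong (2 ^_) (m∸n+n≡m m≤t+l) ⟩
  2 ^ (t + l)              ≡⟨ ^-distribˡ-+-* 2 t l ⟩
  2 ^ t * 2 ^ l            ∣⟨ *-monoʳ-∣ (2 ^ t) d ⟩
  2 ^ t * (2 ^ m * x)      ≡⟨ x∙yz≈xz∙y (2 ^ t) (2 ^ m) x ⟩
  2 ^ t * x * 2 ^ m        ∎)
  where open ∣-Reasoning

2^[n∸m]∣4^sum*z : ∀ {n m} μ → (∀ m′ → m′ * suc m′ ≤ 2 * n → m′ ≤ m) → deg μ ≡ n →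
  2 ^ (n ∸ m) ∣ (2 ^ sumℕ μ * 2 ^ sumℕ μ) * z μ
2^[n∸m]∣4^sum*z {n} {m} μ maximal refl = begin
  2 ^ (deg μ ∸ m)             ≡⟨ cong (λ d → 2 ^ (d ∸ m)) (deg≡2sum+length μ) ⟩
  2 ^ (s + s + length μ ∸ m)  ∣⟨ 2^-∣-shift (s + s) (length μ) m 2^length∣2^m*z ⟩
  2 ^ (s + s) * z μ           ≡⟨ cong (_* z μ) (^-distribˡ-+-* 2 s s) ⟩
  (2 ^ s * 2 ^ s) * z μ       ∎
  where
  open ∣-Reasoning
  s = sumℕ μ
  B = length (glaisherOf μ)
  2^length∣2^m*z : 2 ^ length μ ∣ 2 ^ m * z μ
  2^length∣2^m*z = ∣-trans (2^length∣2^#glaisherOf*z μ)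
    (*-monoˡ-∣ (z μ) (2^-mono-∣ (maximal B (glaisherOf-triangular μ))))

fromℚᵘ-≃toℚᵘ : ∀ {u p} → u ℚᵘ.≃ toℚᵘ p → fromℚᵘ u ≡ p
fromℚᵘ-≃toℚᵘ {p = p} u≃p = trans (ℚ.fromℚᵘ-cong u≃p) (ℚ.fromℚᵘ-toℚᵘ p)

fromℚᵘ-homo-+ : ∀ u v → fromℚᵘ (u ℚᵘ.+ v) ≡ fromℚᵘ u ℚ.+ fromℚᵘ v
fromℚᵘ-homo-+ u v = fromℚᵘ-≃toℚᵘ (ℚᵘ.≃-trans
  (ℚᵘ.+-cong (ℚᵘ.≃-sym (ℚ.toℚᵘ-fromℚᵘ u)) (ℚᵘ.≃-sym (ℚ.toℚᵘ-fromℚᵘ v)))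
  (ℚᵘ.≃-sym (ℚ.toℚᵘ-homo-+ (fromℚᵘ u) (fromℚᵘ v))))

fromℚᵘ-homo-* : ∀ u v → fromℚᵘ (u ℚᵘ.* v) ≡ fromℚᵘ u ℚ.* fromℚᵘ v
fromℚᵘ-homo-* u v = fromℚᵘ-≃toℚᵘ (ℚᵘ.≃-trans
  (ℚᵘ.*-cong (ℚᵘ.≃-sym (ℚ.toℚᵘ-fromℚᵘ u)) (ℚᵘ.≃-sym (ℚ.toℚᵘ-fromℚᵘ v)))
  (ℚᵘ.≃-sym (ℚ.toℚᵘ-homo-* (fromℚᵘ u) (fromℚᵘ v))))

ℕ→ℚ-homo-* : ∀ a b → ℕ→ℚ (a * b) ≡ ℕ→ℚ a ℚ.* ℕ→ℚ b
ℕ→ℚ-homo-* a b =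
  trans (cong (λ c → fromℚᵘ (mkℚᵘ c 0)) (pos-* a b)) (fromℚᵘ-homo-* (mkℚᵘ (ℤ.+ a) 0) (mkℚᵘ (ℤ.+ b) 0))

InZ2-ℕ : ∀ a → InZ2 (ℕ→ℚ a)
InZ2-ℕ a = ℤ.+ a , 0 , refl

InZ2-fromℚᵘ : ∀ w c → ℚᵘ.↧ₙ w ≡ suc (2 * c) → InZ2 (fromℚᵘ w)
InZ2-fromℚᵘ (mkℚᵘ a _) c refl = a , c , refl

odd*odd : ∀ c d → suc (2 * c) * suc (2 * d) ≡ suc (2 * (d + c * suc (2 * d)))
odd*odd = solve-∀

InZ2-+ : ∀ {x y} → InZ2 x → InZ2 y → InZ2 (x ℚ.+ y)
InZ2-+ (a , c , refl) (b , d , refl) = subst InZ2 (fromℚᵘ-homo-+ (mkℚᵘ a (2 * c)) (mkℚᵘ b (2 * d)))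
  (InZ2-fromℚᵘ (mkℚᵘ a (2 * c) ℚᵘ.+ mkℚᵘ b (2 * d)) (d + c * suc (2 * d)) (odd*odd c d))

InZ2-* : ∀ {x y} → InZ2 x → InZ2 y → InZ2 (x ℚ.* y)
InZ2-* (a , c , refl) (b , d , refl) = subst InZ2 (fromℚᵘ-homo-* (mkℚᵘ a (2 * c)) (mkℚᵘ b (2 * d)))
  (InZ2-fromℚᵘ (mkℚᵘ a (2 * c) ℚᵘ.* mkℚᵘ b (2 * d)) (d + c * suc (2 * d)) (odd*odd c d))

module _ {e : ℕ} where

  In2PowZ2-0 : In2PowZ2 e 0ℚ
  In2PowZ2-0 = 0ℚ , InZ2-ℕ 0 , sym (ℚ.*-zeroʳ (ℕ→ℚ (2 ^ e)))

  In2PowZ2-+ : ∀ {x y} → In2PowZ2 e x → In2PowZ2 e y → In2PowZ2 e (x ℚ.+ y)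
  In2PowZ2-+ (x′ , x′∈ , refl) (y′ , y′∈ , refl) =
    x′ ℚ.+ y′ , InZ2-+ x′∈ y′∈ , sym (ℚ.*-distribˡ-+ (ℕ→ℚ (2 ^ e)) x′ y′)

  In2PowZ2-*ˡ : ∀ {a x} → InZ2 a → In2PowZ2 e x → In2PowZ2 e (a ℚ.* x)
  In2PowZ2-*ˡ {a} a∈ (x′ , x′∈ , refl) = a ℚ.* x′ , InZ2-* a∈ x′∈ , ℚ*.x∙yz≈y∙xz a (ℕ→ℚ (2 ^ e)) x′

  In2PowZ2-sum : ∀ {xs} → All (In2PowZ2 e) xs → In2PowZ2 e (sumℚ xs)
  In2PowZ2-sum []         = In2PowZ2-0
  In2PowZ2-sum (x∈ ∷ xs∈) = In2PowZ2-+ x∈ (In2PowZ2-sum xs∈)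

  ∣⇒In2PowZ2 : ∀ {w} → 2 ^ e ∣ w → In2PowZ2 e (ℕ→ℚ w)
  ∣⇒In2PowZ2 (divides q refl) =
    ℕ→ℚ q , InZ2-ℕ q , trans (cong ℕ→ℚ (*-comm q (2 ^ e))) (ℕ→ℚ-homo-* (2 ^ e) q)

module _ {n m : ℕ} (maximal : ∀ m′ → m′ * suc m′ ≤ 2 * n → m′ ≤ m) where

  q-monoForm-In2PowZ2 : ∀ μ ν → deg μ ≡ n →
    In2PowZ2 (n ∸ m) (ℕ→ℚ (2 ^ sumℕ μ) ℚ.* ℕ→ℚ (2 ^ sumℕ ν) ℚ.* monoForm μ ν)
  q-monoForm-In2PowZ2 μ ν deg≡ with ≡-dec _≟_ (sort μ) (sort ν)
  ... | no _ = subst (In2PowZ2 (n ∸ m))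
    (sym (ℚ.*-zeroʳ (ℕ→ℚ (2 ^ sumℕ μ) ℚ.* ℕ→ℚ (2 ^ sumℕ ν)))) (In2PowZ2-0 {n ∸ m})
  ... | yes sorted≡ = subst (In2PowZ2 (n ∸ m)) value
    (∣⇒In2PowZ2 {n ∸ m} (2^[n∸m]∣4^sum*z μ maximal deg≡))
    where
    s = sumℕ μ
    sum≡ : s ≡ sumℕ ν
    sum≡ = sum-↭ (↭-trans (↭-sym (sort-↭ μ)) (subst (_↭ ν) (sym sorted≡) (sort-↭ ν)))
    value : ℕ→ℚ ((2 ^ s * 2 ^ s) * z μ) ≡ ℕ→ℚ (2 ^ s) ℚ.* ℕ→ℚ (2 ^ sumℕ ν) ℚ.* ℕ→ℚ (z μ)
    value = begin
      ℕ→ℚ ((2 ^ s * 2 ^ s) * z μ)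
        ≡⟨ ℕ→ℚ-homo-* (2 ^ s * 2 ^ s) (z μ) ⟩
      ℕ→ℚ (2 ^ s * 2 ^ s) ℚ.* ℕ→ℚ (z μ)
        ≡⟨ cong (ℚ._* ℕ→ℚ (z μ)) (ℕ→ℚ-homo-* (2 ^ s) (2 ^ s)) ⟩
      ℕ→ℚ (2 ^ s) ℚ.* ℕ→ℚ (2 ^ s) ℚ.* ℕ→ℚ (z μ)
        ≡⟨ cong (λ t → ℕ→ℚ (2 ^ s) ℚ.* ℕ→ℚ (2 ^ t) ℚ.* ℕ→ℚ (z μ)) sum≡ ⟩
      ℕ→ℚ (2 ^ s) ℚ.* ℕ→ℚ (2 ^ sumℕ ν) ℚ.* ℕ→ℚ (z μ)
        ∎
      where open ≡-Reasoning

  form-In2PowZ2 : ∀ f g → HomogΔ n f → All (InZ2 ∘ proj₁) g →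
    In2PowZ2 (n ∸ m) (form (toR f) (toR g))
  form-In2PowZ2 f g f-homog g∈Δ = In2PowZ2-sum {n ∸ m} (All.map⁺ (All.map⁺ (All.map row f-homog)))
    where
    row : ∀ {t} → InZ2 (proj₁ t) × deg (proj₂ t) ≡ n → In2PowZ2 (n ∸ m) (sumℚ (map
      (λ s → proj₁ t ℚ.* ℕ→ℚ (2 ^ sumℕ (proj₂ t)) ℚ.* proj₁ s ℚ.* monoForm (proj₂ t) (proj₂ s)) (toR g)))
    row {a , μ} (a∈ , deg≡) = In2PowZ2-sum {n ∸ m} (All.map⁺ (All.map⁺ (All.map entry g∈Δ)))
      where
      entry : ∀ {s} → InZ2 (proj₁ s) → In2PowZ2 (n ∸ m)
        (a ℚ.* ℕ→ℚ (2 ^ sumℕ μ) ℚ.* (proj₁ s ℚ.* ℕ→ℚ (2 ^ sumℕ (proj₂ s))) ℚ.* monoForm μ (proj₂ s))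
      entry {b , ν} b∈ = subst (In2PowZ2 (n ∸ m)) (sym regroup)
        (In2PowZ2-*ˡ {n ∸ m} (InZ2-* a∈ b∈) (q-monoForm-In2PowZ2 μ ν deg≡))
        where
        regroup : a ℚ.* ℕ→ℚ (2 ^ sumℕ μ) ℚ.* (b ℚ.* ℕ→ℚ (2 ^ sumℕ ν)) ℚ.* monoForm μ ν
                ≡ (a ℚ.* b) ℚ.* (ℕ→ℚ (2 ^ sumℕ μ) ℚ.* ℕ→ℚ (2 ^ sumℕ ν) ℚ.* monoForm μ ν)
        regroup = trans (cong (ℚ._* monoForm μ ν) (ℚ*.interchange a _ b _)) (ℚ.*-assoc (a ℚ.* b) _ _)

theorem3p6 : (n m : ℕ)
    → m * suc m ≤ 2 * n
    → (∀ m′ → m′ * suc m′ ≤ 2 * n → m′ ≤ m)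
    → (f g : ΔExpr) → HomogΔ n f → HomogΔ n g
    → In2PowZ2 (n ∸ m) (form (toR f) (toR g))
theorem3p6 n m _ maximal f g f-homog g-homog =
  form-In2PowZ2 maximal f g f-homog (All.map proj₁ g-homog)
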